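{- Let $v$ be a totally denoting $tv$-valuation of a first-order language $\mathcal L$, and let $\uparrow$ be a constant not belonging to $\mathcal L$. Then $v$ can be extended to a $tv$-valuation with equality $v^{\uparrow}$ of the language $\mathcal L+\uparrow$ such that $\bar v(F)=\overline{v^{\uparrow}}(F)$ for every pure formula $F$ of $\mathcal L$, and $\uparrow$ is non-denoting with respect to $v^\uparrow$, i.e. there is no individual parameter $a$ with $v^\uparrow(a=\uparrow)=\mathbf t$.
   Context: A first-order language has: a countable supply of variables (used for quantification), an infinite supply of individual parameters (free names that are never bound), constants, function symbols, relation symbols, $=$ and $\bot$. A term is pure if no variable occurs in it; a formula is pure if no variable occurs free in it. A $tv$-valuation of a language is a total function $v$ from its pure atomic formulae to $\{\mathbf t,\mathbf f\}$ with $v(\bot)=\mathbf f$, extended to $\bar v$ on pure formulae by the classical truth tables and: $\bar v(\forall x H)=\mathbf t$ iff $\bar v(H\{x/a\})=\mathbf t$ for every individual parameter $a$, $\bar v(\exists xH)=\mathbf t$ iff this holds for some parameter $a$. A $tv$-valuation with equality is one for which $r=^v s:\iff v(r=s)=\mathbf t$ is an equivalence relation on pure terms which is a congruence with respect to all function symbols and all relations $\{(t_1,\dots,t_n):v(p(t_1,\dots,t_n))=\mathbf t\}$. It is totally denoting if moreover for every pure term $t$ there is an individual parameter $a$ with $v(a=t)=\mathbf t$. "Extended" means $v^\uparrow$ agrees with $v$ on pure atomic formulae of $\mathcal L$. -}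

module Defs where

open import Data.Nat using (ℕ; _≟_)
open import Data.Bool using (Bool; true; false)
open import Data.Maybe using (Maybe; just; nothing; maybe)
open import Data.List using (List; []; _∷_)
open import Data.List.Membership.Propositional using (_∈_)
open import Data.Vec using (Vec; []; _∷_)
open import Data.Vec.Relation.Unary.All using (All)
open import Data.Vec.Relation.Binary.Pointwise.Inductive using (Pointwise)
open import Data.Product using (Σ; ∃; _×_; _,_)
open import Data.Sum using (_⊎_)
open import Relation.Nullary using (¬_; yes; no)
open import Relation.Binary.PropositionalEquality using (_≡_)

record Signature : Set₁ where
  field
    Const    : Set
    Fun      : Set
    funArity : Fun → ℕ
    Rel      : Set
    relArity : Rel → ℕ
open Signature public

Var : Set
Var = ℕ

Param : Set
Param = ℕ

data Term (L : Signature) : Set where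
  var : Var → Term L
  par : Param → Term L
  con : Const L → Term L
  app : (f : Fun L) → Vec (Term L) (funArity L f) → Term L

data Atom (L : Signature) : Set where
  rel    : (p : Rel L) → Vec (Term L) (relArity L p) → Atom L
  _≐_    : Term L → Term L → Atom L
  falsum : Atom L

infix 6 _≐_

data Formula (L : Signature) : Set where
  atom  : Atom L → Formula L
  ¬'_   : Formula L → Formula L
  _∧'_  : Formula L → Formula L → Formula L
  _∨'_  : Formula L → Formula L → Formula L
  _⇒'_  : Formula L → Formula L → Formula L
  all'  : Var → Formula L → Formula L
  ex'   : Var → Formula L → Formula L

module _ {L : Signature} where

  data TermIn (bs : List Var) : Term L → Set where
    var : ∀ {x} → x ∈ bs → TermIn bs (var x)
    par : ∀ {a} → TermIn bs (par a)
    con : ∀ {c} → TermIn bs (con c)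
    app : ∀ {f ts} → All (TermIn bs) ts → TermIn bs (app f ts)

  data AtomIn (bs : List Var) : Atom L → Set where
    rel    : ∀ {p ts} → All (TermIn bs) ts → AtomIn bs (rel p ts)
    eq     : ∀ {t s} → TermIn bs t → TermIn bs s → AtomIn bs (t ≐ s)
    falsum : AtomIn bs falsum

  data FormulaIn (bs : List Var) : Formula L → Set where
    atom : ∀ {A} → AtomIn bs A → FormulaIn bs (atom A)
    neg  : ∀ {F} → FormulaIn bs F → FormulaIn bs (¬' F)
    and  : ∀ {F G} → FormulaIn bs F → FormulaIn bs G → FormulaIn bs (F ∧' G)
    or   : ∀ {F G} → FormulaIn bs F → FormulaIn bs G → FormulaIn bs (F ∨' G)
    imp  : ∀ {F G} → FormulaIn bs F → FormulaIn bs G → FormulaIn bs (F ⇒' G)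
    all  : ∀ {x F} → FormulaIn (x ∷ bs) F → FormulaIn bs (all' x F)
    ex   : ∀ {x F} → FormulaIn (x ∷ bs) F → FormulaIn bs (ex' x F)

  PureTerm : Term L → Set
  PureTerm = TermIn []

  PureAtom : Atom L → Set
  PureAtom = AtomIn []

  PureFormula : Formula L → Set
  PureFormula = FormulaIn []

Env : Set
Env = Var → Maybe Param

emptyEnv : Env
emptyEnv _ = nothing

_[_↦_] : Env → Var → Param → Env
(ρ [ x ↦ a ]) y with y ≟ x
... | yes _ = just a
... | no _  = ρ y

module _ {L : Signature} where

  mutual
    substT : Env → Term L → Term L
    substT ρ (var x)    = maybe par (var x) (ρ x)
    substT ρ (par a)    = par a
    substT ρ (con c)    = con c
    substT ρ (app f ts) = app f (substTs ρ ts)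

    substTs : ∀ {n} → Env → Vec (Term L) n → Vec (Term L) n
    substTs ρ []       = []
    substTs ρ (t ∷ ts) = substT ρ t ∷ substTs ρ ts

  substA : Env → Atom L → Atom L
  substA ρ (rel p ts) = rel p (substTs ρ ts)
  substA ρ (t ≐ s)    = substT ρ t ≐ substT ρ s
  substA ρ falsum     = falsum

-- tv-valuations.  (Values on impure atoms are irrelevant junk; all
-- conditions below only concern pure atoms.)

record TVValuation (L : Signature) : Set where
  field
    val       : Atom L → Bool
    val-falsum : val falsum ≡ false
open TVValuation public

-- Satisfaction: Sat v ρ H  expresses  v̄(H ρ) = t,  where H ρ is H with
-- the substitution ρ of parameters for free variables performed.
Sat : ∀ {L} → TVValuation L → Env → Formula L → Set
Sat v ρ (atom A)   = val v (substA ρ A) ≡ true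
Sat v ρ (¬' F)     = ¬ Sat v ρ F
Sat v ρ (F ∧' G)   = Sat v ρ F × Sat v ρ G
Sat v ρ (F ∨' G)   = Sat v ρ F ⊎ Sat v ρ G
Sat v ρ (F ⇒' G)   = Sat v ρ F → Sat v ρ G
Sat v ρ (all' x H) = ∀ (a : Param) → Sat v (ρ [ x ↦ a ]) H
Sat v ρ (ex' x H)  = ∃ λ (a : Param) → Sat v (ρ [ x ↦ a ]) H

Holds : ∀ {L} → TVValuation L → Formula L → Set
Holds v F = Sat v emptyEnv F

module _ {L : Signature} (v : TVValuation L) where

  EqV : Term L → Term L → Set
  EqV r s = val v (r ≐ s) ≡ true

  record IsWithEquality : Set where
    field
      eq-refl  : ∀ t → PureTerm t → EqV t t
      eq-sym   : ∀ t s → PureTerm t → PureTerm s → EqV t s → EqV s t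
      eq-trans : ∀ t s u → PureTerm t → PureTerm s → PureTerm u →
                 EqV t s → EqV s u → EqV t u
      eq-congFun : ∀ (f : Fun L) (ts ss : Vec (Term L) (funArity L f)) →
                   All PureTerm ts → All PureTerm ss →
                   Pointwise EqV ts ss → EqV (app f ts) (app f ss)
      eq-congRel : ∀ (p : Rel L) (ts ss : Vec (Term L) (relArity L p)) →
                   All PureTerm ts → All PureTerm ss →
                   Pointwise EqV ts ss →
                   val v (rel p ts) ≡ true → val v (rel p ss) ≡ true

  TotallyDenoting : Set
  TotallyDenoting = ∀ t → PureTerm t → ∃ λ (a : Param) → EqV (par a) t

_+↑ : Signature → Signature
L +↑ = record L { Const = Maybe (Const L) }

↑ : ∀ {L} → Term (L +↑)
↑ = con nothing

module _ {L : Signature} where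

  mutual
    embT : Term L → Term (L +↑)
    embT (var x)    = var x
    embT (par a)    = par a
    embT (con c)    = con (just c)
    embT (app f ts) = app f (embTs ts)

    embTs : ∀ {n} → Vec (Term L) n → Vec (Term (L +↑)) n
    embTs []       = []
    embTs (t ∷ ts) = embT t ∷ embTs ts

  embA : Atom L → Atom (L +↑)
  embA (rel p ts) = rel p (embTs ts)
  embA (t ≐ s)    = embT t ≐ embT s
  embA falsum     = falsum

  embF : Formula L → Formula (L +↑)
  embF (atom A)   = atom (embA A)
  embF (¬' F)     = ¬' embF F
  embF (F ∧' G)   = embF F ∧' embF G
  embF (F ∨' G)   = embF F ∨' embF G
  embF (F ⇒' G)   = embF F ⇒' embF G
  embF (all' x F) = all' x (embF F)
  embF (ex' x F)  = ex' x (embF F)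

-- Extend v by one "undefined" object, the common value of every term in
-- which ↑ occurs: such terms are equal to each other and to nothing else,
-- and no relation holds of them.  Terms without ↑ are interpreted by v,
-- hence every atom of L keeps its value; as the quantifiers range over
-- parameters, which never contain ↑, every formula of L keeps its value.
-- The equality axioms for v↑ reduce to those for v on defined terms and
-- are trivial on undefined ones.
module Submission where

open import Defs
open import Level using (Level)
open import Data.Bool using (Bool; true; false)
open import Data.Product using (Σ; ∃; _×_; _,_)
open import Data.Product.Function.NonDependent.Propositional using (_×-⇔_)
open import Data.Product.Function.Dependent.Propositional using (Σ-⇔)
open import Data.Sum.Function.Propositional using (_⊎-⇔_)
open import Data.Maybe using (Maybe; just; nothing; maybe; zipWith)
import Data.Maybe as Maybe
open import Data.Maybe.Relation.Unary.All as MaybeAll using (just; nothing)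
open import Data.Maybe.Relation.Unary.All.Properties using (map⁺)
open import Data.Maybe.Relation.Binary.Pointwise as MaybePW using (just; nothing)
open import Data.Vec using (Vec; []; _∷_)
open import Data.Vec.Relation.Unary.All using (All; []; _∷_)
open import Data.Vec.Relation.Binary.Pointwise.Inductive using (Pointwise; []; _∷_)
open import Relation.Nullary using (¬_)
open import Relation.Binary.PropositionalEquality
  using (_≡_; refl; sym; trans; cong; cong₂)
open import Function.Bundles using (_⇔_; mk⇔; Equivalence)
open import Function.Related.TypeIsomorphisms using (→-cong-⇔; ¬-cong-⇔)
import Function.Construct.Identity as Identity

private
  variable
    a b c p q r s : Level
    A B C : Set a

module _ {P : A → Set p} {R : A → A → Set r} where

  pointwise-refl-on : (∀ {x} → P x → R x x) →
                      ∀ {m} → MaybeAll.All P m → MaybePW.Pointwise R m m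
  pointwise-refl-on refl-on (just px) = just (refl-on px)
  pointwise-refl-on refl-on nothing   = nothing

  pointwise-sym-on : (∀ {x y} → P x → P y → R x y → R y x) →
                     ∀ {m k} → MaybeAll.All P m → MaybeAll.All P k →
                     MaybePW.Pointwise R m k → MaybePW.Pointwise R k m
  pointwise-sym-on sym-on (just px) (just py) (just rxy) = just (sym-on px py rxy)
  pointwise-sym-on sym-on nothing   nothing   nothing    = nothing

  pointwise-trans-on : (∀ {x y z} → P x → P y → P z → R x y → R y z → R x z) →
                       ∀ {m k l} →
                       MaybeAll.All P m → MaybeAll.All P k → MaybeAll.All P l →
                       MaybePW.Pointwise R m k → MaybePW.Pointwise R k l →
                       MaybePW.Pointwise R m l
  pointwise-trans-on trans-on (just px) (just py) (just pz) (just rxy) (just ryz) =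
    just (trans-on px py pz rxy ryz)
  pointwise-trans-on trans-on nothing nothing nothing nothing nothing = nothing

module _ {f : A → B → C} where

  zipWith-All : {P : A → Set p} {Q : B → Set q} {R : C → Set r} →
                (∀ {x y} → P x → Q y → R (f x y)) →
                ∀ {m n} → MaybeAll.All P m → MaybeAll.All Q n →
                MaybeAll.All R (zipWith f m n)
  zipWith-All f-resp (just px) (just qy) = just (f-resp px qy)
  zipWith-All f-resp (just px) nothing   = nothing
  zipWith-All f-resp nothing   _         = nothing

  zipWith-Pointwise : {R : A → A → Set r} {S : B → B → Set s} {T : C → C → Set q} →
                      (∀ {x x′ y y′} → R x x′ → S y y′ → T (f x y) (f x′ y′)) →
                      ∀ {m m′ n n′} → MaybePW.Pointwise R m m′ → MaybePW.Pointwise S n n′ →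
                      MaybePW.Pointwise T (zipWith f m n) (zipWith f m′ n′)
  zipWith-Pointwise f-resp (just rx) (just sy) = just (f-resp rx sy)
  zipWith-Pointwise f-resp (just rx) nothing   = nothing
  zipWith-Pointwise f-resp nothing   _         = nothing

module _ {L : Signature} where

  mutual
    substT-embT : ∀ ρ (t : Term L) → substT ρ (embT t) ≡ embT (substT ρ t)
    substT-embT ρ (var x) with ρ x
    ... | just a  = refl
    ... | nothing = refl
    substT-embT ρ (par a)    = refl
    substT-embT ρ (con c)    = refl
    substT-embT ρ (app f ts) = cong (app f) (substTs-embTs ρ ts)

    substTs-embTs : ∀ {n} ρ (ts : Vec (Term L) n) → substTs ρ (embTs ts) ≡ embTs (substTs ρ ts)
    substTs-embTs ρ []       = refl
    substTs-embTs ρ (t ∷ ts) = cong₂ _∷_ (substT-embT ρ t) (substTs-embTs ρ ts)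

  substA-embA : ∀ ρ (A : Atom L) → substA ρ (embA A) ≡ embA (substA ρ A)
  substA-embA ρ (rel p ts) = cong (rel p) (substTs-embTs ρ ts)
  substA-embA ρ (t ≐ s)    = cong₂ _≐_ (substT-embT ρ t) (substT-embT ρ s)
  substA-embA ρ falsum     = refl

  Sat-embF : (v : TVValuation L) (w : TVValuation (L +↑)) →
             (∀ A → val w (embA A) ≡ val v A) →
             ∀ ρ F → Sat v ρ F ⇔ Sat w ρ (embF F)
  Sat-embF v w w-embA = go
    where
    atomValue : ∀ ρ A → val w (substA ρ (embA A)) ≡ val v (substA ρ A)
    atomValue ρ A = trans (cong (val w) (substA-embA ρ A)) (w-embA (substA ρ A))

    go : ∀ ρ F → Sat v ρ F ⇔ Sat w ρ (embF F)
    go ρ (atom A)   = mk⇔ (trans (atomValue ρ A)) (trans (sym (atomValue ρ A)))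
    go ρ (¬' F)     = ¬-cong-⇔ (go ρ F)
    go ρ (F ∧' G)   = go ρ F ×-⇔ go ρ G
    go ρ (F ∨' G)   = go ρ F ⊎-⇔ go ρ G
    go ρ (F ⇒' G)   = →-cong-⇔ (go ρ F) (go ρ G)
    go ρ (all' x F) = mk⇔ (λ h a → Equivalence.to   (go _ F) (h a))
                          (λ h a → Equivalence.from (go _ F) (h a))
    go ρ (ex' x F)  = Σ-⇔ (Identity.↠-id _) (go _ F)

  -- nothing is the undefined object.
  mutual
    erase : Term (L +↑) → Maybe (Term L)
    erase (var x)        = just (var x)
    erase (par a)        = just (par a)
    erase (con nothing)  = nothing
    erase (con (just c)) = just (con c)
    erase (app f ts)     = Maybe.map (app f) (eraseAll ts)

    eraseAll : ∀ {n} → Vec (Term (L +↑)) n → Maybe (Vec (Term L) n)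
    eraseAll []       = just []
    eraseAll (t ∷ ts) = zipWith _∷_ (erase t) (eraseAll ts)

  mutual
    erase-embT : ∀ t → erase (embT t) ≡ just t
    erase-embT (var x)    = refl
    erase-embT (par a)    = refl
    erase-embT (con c)    = refl
    erase-embT (app f ts) = cong (Maybe.map (app f)) (eraseAll-embTs ts)

    eraseAll-embTs : ∀ {n} (ts : Vec (Term L) n) → eraseAll (embTs ts) ≡ just ts
    eraseAll-embTs []       = refl
    eraseAll-embTs (t ∷ ts) = cong₂ (zipWith _∷_) (erase-embT t) (eraseAll-embTs ts)

  mutual
    erase-pure : ∀ {t} → PureTerm t → MaybeAll.All PureTerm (erase t)
    erase-pure {par a}        par       = just par
    erase-pure {con nothing}  con       = nothing
    erase-pure {con (just c)} con       = just con
    erase-pure {app f ts}     (app pts) = map⁺ (MaybeAll.map app (eraseAll-pure pts))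

    eraseAll-pure : ∀ {n} {ts : Vec (Term (L +↑)) n} →
                    All PureTerm ts → MaybeAll.All (All PureTerm) (eraseAll ts)
    eraseAll-pure []         = just []
    eraseAll-pure (pt ∷ pts) = zipWith-All _∷_ (erase-pure pt) (eraseAll-pure pts)

module UndefinedExtension {L : Signature} (v : TVValuation L) where

  liftEq : Maybe (Term L) → Maybe (Term L) → Bool
  liftEq (just t) (just s) = val v (t ≐ s)
  liftEq nothing  nothing  = true
  liftEq _        _        = false

  liftEq-sound : ∀ {m k} → liftEq m k ≡ true → MaybePW.Pointwise (EqV v) m k
  liftEq-sound {just t}  {just s}  t=s = just t=s
  liftEq-sound {nothing} {nothing} _   = nothing

  liftEq-complete : ∀ {m k} → MaybePW.Pointwise (EqV v) m k → liftEq m k ≡ true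
  liftEq-complete (just t=s) = t=s
  liftEq-complete nothing    = refl

  valUndef : Atom (L +↑) → Bool
  valUndef (rel p ts) = maybe (λ us → val v (rel p us)) false (eraseAll ts)
  valUndef (t ≐ s)    = liftEq (erase t) (erase s)
  valUndef falsum     = false

  v↑ : TVValuation (L +↑)
  v↑ = record { val = valUndef ; val-falsum = refl }

  v↑-embA : ∀ A → val v↑ (embA A) ≡ val v A
  v↑-embA (rel p ts) = cong (maybe (λ us → val v (rel p us)) false) (eraseAll-embTs ts)
  v↑-embA (t ≐ s)    = cong₂ liftEq (erase-embT t) (erase-embT s)
  v↑-embA falsum     = sym (val-falsum v)

  ↑-nonDenoting : ¬ (∃ λ (a : Param) → val v↑ (par a ≐ ↑) ≡ true)
  ↑-nonDenoting (a , ())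

  eraseAll-EqV : ∀ {n} {ts ss : Vec (Term (L +↑)) n} → Pointwise (EqV v↑) ts ss →
                 MaybePW.Pointwise (Pointwise (EqV v)) (eraseAll ts) (eraseAll ss)
  eraseAll-EqV []          = just []
  eraseAll-EqV (t=s ∷ eqs) = zipWith-Pointwise _∷_ (liftEq-sound t=s) (eraseAll-EqV eqs)

  isWithEquality-v↑ : IsWithEquality v → IsWithEquality v↑
  isWithEquality-v↑ eqv = record
    { eq-refl    = λ t pt → liftEq-complete (pointwise-refl-on (eq-refl _) (erase-pure pt))
    ; eq-sym     = λ t s pt ps t=s → liftEq-complete
        (pointwise-sym-on (eq-sym _ _) (erase-pure pt) (erase-pure ps) (liftEq-sound t=s))
    ; eq-trans   = λ t s u pt ps pu t=s s=u → liftEq-complete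
        (pointwise-trans-on (eq-trans _ _ _) (erase-pure pt) (erase-pure ps) (erase-pure pu)
                            (liftEq-sound t=s) (liftEq-sound s=u))
    ; eq-congFun = λ f ts ss pts pss eqs →
        congFun f (eraseAll-pure pts) (eraseAll-pure pss) (eraseAll-EqV eqs)
    ; eq-congRel = λ p ts ss pts pss eqs →
        congRel p (eraseAll-pure pts) (eraseAll-pure pss) (eraseAll-EqV eqs)
    }
    where
    open IsWithEquality eqv

    congFun : ∀ f {ms ks : Maybe (Vec (Term L) (funArity L f))} →
              MaybeAll.All (All PureTerm) ms → MaybeAll.All (All PureTerm) ks →
              MaybePW.Pointwise (Pointwise (EqV v)) ms ks →
              liftEq (Maybe.map (app f) ms) (Maybe.map (app f) ks) ≡ true
    congFun f (just pts) (just pss) (just eqs) = eq-congFun f _ _ pts pss eqs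
    congFun f nothing    nothing    nothing    = refl

    congRel : ∀ p {ms ks : Maybe (Vec (Term L) (relArity L p))} →
              MaybeAll.All (All PureTerm) ms → MaybeAll.All (All PureTerm) ks →
              MaybePW.Pointwise (Pointwise (EqV v)) ms ks →
              maybe (λ us → val v (rel p us)) false ms ≡ true →
              maybe (λ us → val v (rel p us)) false ks ≡ true
    congRel p (just pts) (just pss) (just eqs) = eq-congRel p _ _ pts pss eqs
    congRel p nothing    nothing    nothing    ()

mainTheorem10 : (L : Signature) (v : TVValuation L) →
    IsWithEquality v → TotallyDenoting v →
    Σ (TVValuation (L +↑)) λ w →
      IsWithEquality w
      × (∀ (A : Atom L) → PureAtom A → val w (embA A) ≡ val v A)
      × (∀ (F : Formula L) → PureFormula F → (Holds v F ⇔ Holds w (embF F)))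
      × ¬ (∃ λ (a : Param) → val w (par a ≐ ↑) ≡ true)
mainTheorem10 L v eqv _ =
  v↑ , isWithEquality-v↑ eqv
     , (λ A _ → v↑-embA A)
     , (λ F _ → Sat-embF v v↑ v↑-embA emptyEnv F)
     , ↑-nonDenoting
  where open UndefinedExtension v
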